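{- Let $D$ be a delta-matroid on $[n,\overline n]$, let $A,B\subseteq[n]$ be disjoint, and let $S\in\operatorname{AdS}_n$ be disjoint from $A\cup B\cup\overline A\cup\overline B$. Then $$g_{D/A\setminus B}(S)=g_D(S\cup A\cup\overline B)-g_D(A\cup\overline B).$$
   Context: Let $[n,\overline{n}]=\{1,\dots,n,\overline{1},\dots,\overline{n}\}$ with involution $a\mapsto\overline a$; $\overline S=\{\overline a:a\in S\}$. Admissible sets contain at most one of $i,\overline i$ for each $i$; $\operatorname{AdS}_n$ is their set. For $E\subseteq[n]$, a delta-matroid on $E\cup\overline E$ is a non-empty collection $\mathcal F$ of admissible subsets of $E\cup\overline E$ of size $|E|$ (feasible sets) such that $\operatorname{Conv}\{e_B:B\in\mathcal F\}\subseteq\mathbb{R}^E$ has all edges parallel to some $e_i$ or $e_i\pm e_j$ ($e_{\overline i}=-e_i$, $e_S=\sum_{a\in S}e_a$). Rank function: $g_D(S)=\max_{B'\in\mathcal F}(|S\cap B'|-|\overline S\cap B'|)$. For $i\in E$: $i$ is a loop if no feasible set contains $i$, a coloop if every feasible set contains $i$. If $i$ is not a loop, the contraction $D/i$ has feasible sets $B'\setminus\{i\}$ for feasible $B'\ni i$; if $i$ is not a coloop, the deletion $D\setminus i$ has feasible sets $B'\setminus\{\overline i\}$ for feasible $B'\ni\overline i$; the projection $D(i)$ has feasible sets $B'\setminus\{i,\overline i\}$, $B'\in\mathcal F$; if $i$ is a loop or coloop, $D/i=D\setminus i=D(i)$. All are delta-matroids on $(E\setminus\{i\})\cup\overline{(E\setminus\{i\})}$.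 For disjoint $A,B$, $D/A\setminus B$ is obtained by successively contracting the elements of $A$ and deleting the elements of $B$ (the result is independent of order). -}

module Defs where

open import Data.Nat using (ℕ; zero; suc; _≤_)
open import Data.Integer using (ℤ; +_; _-_; _*_; _<_; _⊔_)
import Data.Integer as ℤ
open import Data.Fin using (Fin; zero; suc)
open import Data.Bool using (Bool; true; false; if_then_else_)
open import Data.Maybe using (Maybe; just; nothing)
open import Data.List using (List; []; _∷_; map; foldr; foldl; filterᵇ; allFin)
open import Data.List.Membership.Propositional using (_∈_)
open import Data.Product using (Σ; _×_)
open import Relation.Binary.PropositionalEquality using (_≡_)
open import Relation.Nullary using (¬_)

-- An admissible subset S of [n, n̄] is encoded by its "signed characteristic
-- function": S i = just true  iff  i ∈ S,
--            S i = just false iff  ī ∈ S,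
--            S i = nothing    iff  neither i nor ī is in S.
-- (At most one of i, ī can be in S, so this is a bijection with AdS_n.)
AdS : ℕ → Set
AdS n = Fin n → Maybe Bool

Sub : ℕ → Set
Sub n = Fin n → Bool

∅ₐ : ∀ {n} → AdS n
∅ₐ _ = nothing

pos : ∀ {n} → Sub n → AdS n
pos A i = if A i then just true else nothing

bar : ∀ {n} → Sub n → AdS n
bar A i = if A i then just false else nothing

-- union of admissible sets (only applied to sets S, T with no common index,
-- in which case it is the ordinary set union)
_∪ₐ_ : ∀ {n} → AdS n → AdS n → AdS n
(S ∪ₐ T) i with S i
... | nothing = T i
... | just b  = just b

count : ∀ {n} → (Fin n → Bool) → ℕ
count {zero}  p = 0
count {suc n} p = (if p zero then 1 else 0) Data.Nat.+ count (λ i → p (suc i))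

sumℤ : ∀ {n} → (Fin n → ℤ) → ℤ
sumℤ {zero}  f = + 0
sumℤ {suc n} f = f zero ℤ.+ sumℤ (λ i → f (suc i))

bothIn : Maybe Bool → Maybe Bool → Bool
bothIn (just true)  (just true)  = true
bothIn (just false) (just false) = true
bothIn _ _ = false

barIn : Maybe Bool → Maybe Bool → Bool
barIn (just true)  (just false) = true
barIn (just false) (just true)  = true
barIn _ _ = false

∣_∩_∣ : ∀ {n} → AdS n → AdS n → ℕ
∣ S ∩ B ∣ = count (λ i → bothIn (S i) (B i))

∣bar_∩_∣ : ∀ {n} → AdS n → AdS n → ℕ
∣bar S ∩ B ∣ = count (λ i → barIn (S i) (B i))

-- e_B ∈ ℤ^n  (e_i, e_ī = -e_i)
eVec : ∀ {n} → AdS n → Fin n → ℤ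
eVec B i with B i
... | just true  = + 1
... | just false = ℤ.- (+ 1)
... | nothing    = + 0

dot : ∀ {n} → (Fin n → ℤ) → AdS n → ℤ
dot c B = sumℤ (λ i → c i * eVec B i)

SameSet : ∀ {n} → AdS n → AdS n → Set
SameSet B B' = ∀ i → B i ≡ B' i

-- {e_B1, e_B2} spans an edge (1-dimensional face) of Conv{e_B : B ∈ F}:
-- some linear functional c is maximised over the feasible points exactly at
-- e_B1 and e_B2.  (All e_B are ±1-vectors, hence all are vertices of the
-- polytope; integral c suffices since c may be rescaled.)
IsEdge : ∀ {n} → List (AdS n) → AdS n → AdS n → Set
IsEdge {n} F B₁ B₂ =
  Σ (Fin n → ℤ) λ c →
    (dot c B₁ ≡ dot c B₂) ×
    (∀ B → B ∈ F → ¬ SameSet B B₁ → ¬ SameSet B B₂ → dot c B < dot c B₁)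

differ : Maybe Bool → Maybe Bool → Bool
differ (just true)  (just true)  = false
differ (just false) (just false) = false
differ nothing      nothing      = false
differ _ _ = true

-- number of coordinates where e_B1 and e_B2 differ; e_B1 - e_B2 is parallel to
-- some e_i or e_i ± e_j  iff  this is 1 or 2 (it is 0 iff B1 = B2).
dist : ∀ {n} → AdS n → AdS n → ℕ
dist B₁ B₂ = count (λ i → differ (B₁ i) (B₂ i))

record DeltaMatroid (n : ℕ) : Set where
  field
    feasible    : List (AdS n)
    nonempty    : Σ (AdS n) λ B → B ∈ feasible
    -- feasible sets are admissible subsets of [n, n̄] of size n,
    -- i.e. contain exactly one of i, ī for every i
    full        : ∀ B → B ∈ feasible → ∀ i → ¬ (B i ≡ nothing)
    edges       : ∀ B₁ B₂ → B₁ ∈ feasible → B₂ ∈ feasible →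
                  IsEdge feasible B₁ B₂ → dist B₁ B₂ ≤ 2
open DeltaMatroid public

-- rank function  g(S) = max_{B' ∈ F} (|S ∩ B'| - |S̄ ∩ B'|)
-- (computed on a list of feasible sets; the list is non-empty in all uses)

rankTerm : ∀ {n} → AdS n → AdS n → ℤ
rankTerm S B = + ∣ S ∩ B ∣ - + ∣bar S ∩ B ∣

rankL : ∀ {n} → List (AdS n) → AdS n → ℤ
rankL []       S = + 0
rankL (B ∷ Fs) S = foldr (λ B' m → rankTerm S B' ⊔ m) (rankTerm S B) Fs

g : ∀ {n} → DeltaMatroid n → AdS n → ℤ
g D S = rankL (feasible D) S

-- minors, on the level of the collection of feasible sets
-- (elements already removed are encoded by "nothing" at that index)

hasSign : Bool → Maybe Bool → Bool
hasSign true  (just true)  = true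
hasSign false (just false) = true
hasSign _ _ = false

anyᵇ : ∀ {A : Set} → (A → Bool) → List A → Bool
anyᵇ p []       = false
anyᵇ p (x ∷ xs) = if p x then true else anyᵇ p xs

eqFin : ∀ {n} → Fin n → Fin n → Bool
eqFin zero    zero    = true
eqFin (suc i) (suc j) = eqFin i j
eqFin _ _ = false

erase : ∀ {n} → Fin n → AdS n → AdS n
erase i B j = if eqFin i j then nothing else B j

projL : ∀ {n} → Fin n → List (AdS n) → List (AdS n)
projL i F = map (erase i) F

-- b = true: contraction D/i ; b = false: deletion D\i.
-- If no feasible set contains i (resp. ī), i.e. i is a loop (resp. coloop),
-- the result is the projection D(i).
minor1 : ∀ {n} → Bool → Fin n → List (AdS n) → List (AdS n)
minor1 b i F =
  if anyᵇ (λ B → hasSign b (B i)) F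
  then map (erase i) (filterᵇ (λ B → hasSign b (B i)) F)
  else projL i F

-- D / A \ B : contract the elements of A and delete those of B, processing
-- the indices 1, …, n in increasing order (the result is order-independent).
minorL : ∀ {n} → Sub n → Sub n → List (AdS n) → List (AdS n)
minorL {n} A B F =
  foldl (λ Fs i → if A i then minor1 true i Fs
                  else (if B i then minor1 false i Fs else Fs))
        F (allFin n)

gMinor : ∀ {n} → DeltaMatroid n → Sub n → Sub n → AdS n → ℤ
gMinor D A B S = rankL (minorL A B (feasible D)) S

{-# OPTIONS --safe #-}
-- A feasible set B is the ±1-vector e_B, and g_D(S) is the maximum of the linear functional e_S
-- over these vertices. Contracting x keeps the feasible sets containing x if there are any; they
-- form the face of the polytope on which e_x is maximal (deleting x: x̄ and −e_x). So every
-- sequential minor is, up to erasing processed coordinates, a face L of the polytope of D, and it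
-- suffices to show g_{L/x}(V) = g_L(V ∪ x) − g_L(x) for V avoiding x, then telescope. The only
-- non-trivial inequality says that a set of L containing x̄ beats the best set of L containing x
-- by at most 2 on V. It holds because the maximizers of a generic functional on the two sides
-- of x span an edge of the polytope, so they differ in at most two coordinates, one of them x.
module Submission where

open import Defs

open import Data.Bool using (Bool; true; false; not; if_then_else_; _∧_; T)
open import Data.Bool.Properties using (T-≡)
open import Data.Fin using (Fin; zero; suc; _≟_)
open import Data.Integer as ℤ using (ℤ; +_; -_; _+_; _-_; _*_; _≤_; _<_; _⊔_; ∣_∣)
import Data.Integer.Properties as ℤP
open import Data.Integer.Tactic.RingSolver using (solve-∀)
open import Data.List using (List; []; _∷_; map; foldr; foldl; filterᵇ; allFin)
open import Data.List.Extrema ℤP.≤-totalOrder using (argmax; argmax-sel; f[xs]≤f[argmax])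
open import Data.List.Membership.Propositional using (_∈_; _∉_)
open import Data.List.Membership.Propositional.Properties
  using (∈-map⁺; ∈-map⁻; ∈-filter⁺; ∈-filter⁻; ∈-allFin; foldr-selective)
open import Data.List.Properties using (foldr-preservesᵒ; foldr-map; foldl-cong; map-cong; map-id)
open import Data.List.Relation.Binary.Pointwise as Pointwise using (Pointwise; []; _∷_)
import Data.List.Relation.Unary.All as All
open import Data.List.Relation.Unary.AllPairs using ([]; _∷_)
import Data.List.Relation.Unary.Any as Any
open import Data.List.Relation.Unary.Any using (here; there)
open import Data.List.Relation.Unary.Unique.Propositional using (Unique)
open import Data.List.Relation.Unary.Unique.Propositional.Properties using (allFin⁺)
open import Data.Maybe using (Maybe; just; nothing; is-just; _<∣>_)
open import Data.Nat as ℕ using (ℕ)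
import Data.Nat.Properties as ℕP
open import Data.Product using (∃; _×_; _,_; proj₁; proj₂)
open import Data.Sum using (_⊎_; inj₁; inj₂; [_,_]; map₁; map₂)
open import Function using (_∘_; id; _⇔_; mk⇔; Equivalence)
open import Relation.Binary.Definitions using (tri<; tri≈; tri>)
open import Relation.Binary.PropositionalEquality
  using (_≡_; _≢_; refl; sym; trans; cong; cong₂; subst; subst₂; module ≡-Reasoning)
open import Relation.Nullary using (¬_; contradiction; yes; no)
open import Relation.Nullary.Decidable using (True; toWitness; T?)

open import Algebra.Properties.AbelianGroup ℤP.+-0-abelianGroup using (∙-cancelˡ)
open import Algebra.Properties.CommutativeSemigroup ℤP.+-commutativeSemigroup using (interchange)

private
  variable
    n : ℕ

sumℤ-cong : {f g : Fin n → ℤ} → (∀ i → f i ≡ g i) → sumℤ f ≡ sumℤ g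
sumℤ-cong {ℕ.zero}  f≗g = refl
sumℤ-cong {ℕ.suc n} f≗g = cong₂ _+_ (f≗g zero) (sumℤ-cong (f≗g ∘ suc))

sumℤ-zero : {f : Fin n → ℤ} → (∀ i → f i ≡ + 0) → sumℤ f ≡ + 0
sumℤ-zero {ℕ.zero}  f≗0 = refl
sumℤ-zero {ℕ.suc n} f≗0 = cong₂ _+_ (f≗0 zero) (sumℤ-zero (f≗0 ∘ suc))

sumℤ-+ : (f g : Fin n → ℤ) → sumℤ (λ i → f i + g i) ≡ sumℤ f + sumℤ g
sumℤ-+ {ℕ.zero}  f g = refl
sumℤ-+ {ℕ.suc n} f g = trans (cong (_+_ (f zero + g zero)) (sumℤ-+ (f ∘ suc) (g ∘ suc)))
                             (interchange (f zero) (g zero) _ _)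

sumℤ-neg : (f : Fin n → ℤ) → sumℤ (λ i → - f i) ≡ - sumℤ f
sumℤ-neg {ℕ.zero}  f = refl
sumℤ-neg {ℕ.suc n} f = trans (cong (_+_ (- f zero)) (sumℤ-neg (f ∘ suc)))
                             (sym (ℤP.neg-distrib-+ (f zero) _))

sumℤ-*ˡ : (k : ℤ) (f : Fin n → ℤ) → sumℤ (λ i → k * f i) ≡ k * sumℤ f
sumℤ-*ˡ {ℕ.zero}  k f = sym (ℤP.*-zeroʳ k)
sumℤ-*ˡ {ℕ.suc n} k f = trans (cong (_+_ (k * f zero)) (sumℤ-*ˡ k (f ∘ suc)))
                              (sym (ℤP.*-distribˡ-+ k (f zero) _))

sumℤ-mono-≤ : {f g : Fin n → ℤ} → (∀ i → f i ≤ g i) → sumℤ f ≤ sumℤ g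
sumℤ-mono-≤ {ℕ.zero}  f≤g = ℤP.≤-refl
sumℤ-mono-≤ {ℕ.suc n} f≤g = ℤP.+-mono-≤ (f≤g zero) (sumℤ-mono-≤ (f≤g ∘ suc))

m+k-k≡m : ∀ m k → (m + k) - k ≡ m
m+k-k≡m = solve-∀

indicator : Bool → ℤ
indicator b = + (if b then 1 else 0)

sumℤ-indicator : (p : Fin n → Bool) → sumℤ (indicator ∘ p) ≡ + count p
sumℤ-indicator {ℕ.zero}  p = refl
sumℤ-indicator {ℕ.suc n} p = trans (cong (_+_ (indicator (p zero))) (sumℤ-indicator (p ∘ suc)))
                                   (sym (ℤP.pos-+ (if p zero then 1 else 0) _))

eqFin-refl : (x : Fin n) → eqFin x x ≡ true
eqFin-refl zero    = refl
eqFin-refl (suc x) = eqFin-refl x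

eqFin-sound : (x y : Fin n) → eqFin x y ≡ true → x ≡ y
eqFin-sound zero    zero    _  = refl
eqFin-sound (suc x) (suc y) eq = cong suc (eqFin-sound x y eq)

sumℤ-single : (x : Fin n) {f : Fin n → ℤ} → (∀ j → eqFin x j ≡ false → f j ≡ + 0) →
              sumℤ f ≡ f x
sumℤ-single {ℕ.suc n} zero    {f} f≗0 =
  trans (cong (_+_ (f zero)) (sumℤ-zero (λ j → f≗0 (suc j) refl))) (ℤP.+-identityʳ (f zero))
sumℤ-single {ℕ.suc n} (suc x) {f} f≗0 =
  trans (cong (_+ sumℤ (f ∘ suc)) (f≗0 zero refl))
        (trans (ℤP.+-identityˡ _) (sumℤ-single x (f≗0 ∘ suc)))

count-mono : {p q : Fin n → Bool} → (∀ j → p j ≡ true → q j ≡ true) → count p ℕ.≤ count q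
count-mono {ℕ.zero}  p⇒q = ℕ.z≤n
count-mono {ℕ.suc n} {p} {q} p⇒q with p zero in pz | q zero in qz
... | true  | true  = ℕ.s≤s (count-mono (p⇒q ∘ suc))
... | true  | false = contradiction (trans (sym (p⇒q zero pz)) qz) λ ()
... | false | true  = ℕP.m≤n⇒m≤1+n (count-mono (p⇒q ∘ suc))
... | false | false = count-mono (p⇒q ∘ suc)

count-< : {p q : Fin n → Bool} (x : Fin n) → (∀ j → p j ≡ true → q j ≡ true) →
          p x ≡ false → q x ≡ true → count p ℕ.< count q
count-< zero p⇒q px qx rewrite px | qx = ℕ.s≤s (count-mono (p⇒q ∘ suc))
count-< {p = p} {q} (suc x) p⇒q px qx with p zero in pz | q zero in qz
... | true  | true  = ℕ.s≤s (count-< x (p⇒q ∘ suc) px qx)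
... | true  | false = contradiction (trans (sym (p⇒q zero pz)) qz) λ ()
... | false | true  = ℕP.m≤n⇒m≤1+n (count-< x (p⇒q ∘ suc) px qx)
... | false | false = count-< x (p⇒q ∘ suc) px qx

dot-+ : (f g : Fin n → ℤ) (B : AdS n) → dot (λ j → f j + g j) B ≡ dot f B + dot g B
dot-+ f g B = trans (sumℤ-cong (λ i → ℤP.*-distribʳ-+ (eVec B i) (f i) (g i)))
                    (sumℤ-+ (λ i → f i * eVec B i) (λ i → g i * eVec B i))

dot-*ˡ : (k : ℤ) (f : Fin n → ℤ) (B : AdS n) → dot (λ j → k * f j) B ≡ k * dot f B
dot-*ˡ k f B = trans (sumℤ-cong (λ i → ℤP.*-assoc k (f i) (eVec B i)))
                     (sumℤ-*ˡ k (λ i → f i * eVec B i))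

rankTerm≡dot : (S B : AdS n) → rankTerm S B ≡ dot (eVec S) B
rankTerm≡dot S B = begin
  + count both - + count opposite
    ≡⟨ sym (cong₂ _-_ (sumℤ-indicator both) (sumℤ-indicator opposite)) ⟩
  sumℤ (indicator ∘ both) - sumℤ (indicator ∘ opposite)
    ≡⟨ sym (trans (sumℤ-+ (indicator ∘ both) (λ i → - indicator (opposite i)))
                  (cong (_+_ (sumℤ (indicator ∘ both))) (sumℤ-neg (indicator ∘ opposite)))) ⟩
  sumℤ (λ i → indicator (both i) - indicator (opposite i))
    ≡⟨ sumℤ-cong coordinate ⟩
  dot (eVec S) B ∎
  where
  open ≡-Reasoning
  both opposite : Fin _ → Bool
  both i     = bothIn (S i) (B i)
  opposite i = barIn (S i) (B i)
  coordinate : ∀ i → indicator (both i) - indicator (opposite i) ≡ eVec S i * eVec B i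
  coordinate i with S i | B i
  ... | just true  | just true  = refl
  ... | just true  | just false = refl
  ... | just true  | nothing    = refl
  ... | just false | just true  = refl
  ... | just false | just false = refl
  ... | just false | nothing    = refl
  ... | nothing    | just _     = refl
  ... | nothing    | nothing    = refl

rankTerm-congˡ : {S S′ : AdS n} → SameSet S S′ → (B : AdS n) → rankTerm S B ≡ rankTerm S′ B
rankTerm-congˡ {S = S} {S′} S≗S′ B =
  trans (rankTerm≡dot S B) (trans (sumℤ-cong coordinate) (sym (rankTerm≡dot S′ B)))
  where
  coordinate : ∀ j → eVec S j * eVec B j ≡ eVec S′ j * eVec B j
  coordinate j rewrite S≗S′ j = refl

rankTerm-congʳ : {S B′ B : AdS n} → (∀ j → S j ≡ nothing ⊎ B′ j ≡ B j) → rankTerm S B′ ≡ rankTerm S B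
rankTerm-congʳ {S = S} {B′} {B} agree =
  trans (rankTerm≡dot S B′) (trans (sumℤ-cong coordinate) (sym (rankTerm≡dot S B)))
  where
  coordinate : ∀ j → eVec S j * eVec B′ j ≡ eVec S j * eVec B j
  coordinate j with agree j
  ... | inj₁ Sj      rewrite Sj      = refl
  ... | inj₂ B′j≡Bj rewrite B′j≡Bj = refl

[_↦_] : Fin n → Maybe Bool → AdS n
[ x ↦ m ] j = if eqFin x j then m else nothing

dot-singleton : (x : Fin n) (σ : Bool) (B : AdS n) →
                dot (eVec [ x ↦ just σ ]) B ≡ eVec [ x ↦ just σ ] x * eVec B x
dot-singleton x σ B = sumℤ-single x vanishes
  where
  vanishes : ∀ j → eqFin x j ≡ false → eVec [ x ↦ just σ ] j * eVec B j ≡ + 0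
  vanishes j x≢j rewrite x≢j = refl

dot-singleton-agree : (x : Fin n) (σ : Bool) (B : AdS n) → B x ≡ just σ →
                      dot (eVec [ x ↦ just σ ]) B ≡ + 1
dot-singleton-agree x σ B Bx rewrite dot-singleton x σ B | eqFin-refl x | Bx with σ
... | true  = refl
... | false = refl

dot-singleton-disagree : (x : Fin n) (σ : Bool) (B : AdS n) → B x ≡ just (not σ) →
                         dot (eVec [ x ↦ just σ ]) B ≡ - + 1
dot-singleton-disagree x σ B Bx rewrite dot-singleton x σ B | eqFin-refl x | Bx with σ
... | true  = refl
... | false = refl

dot-singleton-≤1 : (x : Fin n) (σ : Bool) (B : AdS n) → dot (eVec [ x ↦ just σ ]) B ≤ + 1
dot-singleton-≤1 x σ B rewrite dot-singleton x σ B | eqFin-refl x with σ | B x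
... | true  | just true  = ℤP.≤-refl
... | true  | just false = ℤ.-≤+
... | true  | nothing    = ℤ.+≤+ ℕ.z≤n
... | false | just true  = ℤ.-≤+
... | false | just false = ℤP.≤-refl
... | false | nothing    = ℤ.+≤+ ℕ.z≤n

rankTerm-singleton-agree : (x : Fin n) (σ : Bool) (B : AdS n) → B x ≡ just σ →
                           rankTerm [ x ↦ just σ ] B ≡ + 1
rankTerm-singleton-agree x σ B Bx = trans (rankTerm≡dot _ B) (dot-singleton-agree x σ B Bx)

rankTerm-singleton-disagree : (x : Fin n) (σ : Bool) (B : AdS n) → B x ≡ just (not σ) →
                              rankTerm [ x ↦ just σ ] B ≡ - + 1
rankTerm-singleton-disagree x σ B Bx = trans (rankTerm≡dot _ B) (dot-singleton-disagree x σ B Bx)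

-- Lexicographic combination of functionals

‖_‖ : (Fin n → ℤ) → ℕ
‖_‖ {ℕ.zero}  c = 0
‖_‖ {ℕ.suc n} c = ∣ c zero ∣ ℕ.+ ‖ c ∘ suc ‖

∣eVec∣≤1 : (B : AdS n) (i : Fin n) → ∣ eVec B i ∣ ℕ.≤ 1
∣eVec∣≤1 B i with B i
... | just true  = ℕP.≤-refl
... | just false = ℕP.≤-refl
... | nothing    = ℕ.z≤n

∣dot∣≤‖‖ : (c : Fin n → ℤ) (B : AdS n) → ∣ dot c B ∣ ℕ.≤ ‖ c ‖
∣dot∣≤‖‖ {ℕ.zero}  c B = ℕ.z≤n
∣dot∣≤‖‖ {ℕ.suc n} c B = ℕP.≤-trans (ℤP.∣i+j∣≤∣i∣+∣j∣ (c zero * eVec B zero) _)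
                                     (ℕP.+-mono-≤ first (∣dot∣≤‖‖ (c ∘ suc) (B ∘ suc)))
  where
  first : ∣ c zero * eVec B zero ∣ ℕ.≤ ∣ c zero ∣
  first = begin
    ∣ c zero * eVec B zero ∣       ≡⟨ ℤP.∣i*j∣≡∣i∣*∣j∣ (c zero) (eVec B zero) ⟩
    ∣ c zero ∣ ℕ.* ∣ eVec B zero ∣  ≤⟨ ℕP.*-monoʳ-≤ ∣ c zero ∣ (∣eVec∣≤1 B zero) ⟩
    ∣ c zero ∣ ℕ.* 1               ≡⟨ ℕP.*-identityʳ ∣ c zero ∣ ⟩
    ∣ c zero ∣                     ∎
    where open ℕP.≤-Reasoning

i≤+∣i∣ : (i : ℤ) → i ≤ + ∣ i ∣
i≤+∣i∣ (+ _)      = ℤP.≤-refl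
i≤+∣i∣ ℤ.-[1+ _ ] = ℤ.-≤+

-+∣i∣≤i : (i : ℤ) → - + ∣ i ∣ ≤ i
-+∣i∣≤i (+ ℕ.zero)  = ℤP.≤-refl
-+∣i∣≤i (+ ℕ.suc _) = ℤ.-≤+
-+∣i∣≤i ℤ.-[1+ _ ]  = ℤP.≤-refl

-- Weighting a by 2β + 1 orders the pairs (a, u) with ∣ u ∣ ≤ β lexicographically.
lexℤ : ℕ → ℤ → ℤ → ℤ
lexℤ β a u = + ℕ.suc (β ℕ.+ β) * a + u

lexℤ-< : {β : ℕ} {a a′ u u′ : ℤ} → ∣ u ∣ ℕ.≤ β → ∣ u′ ∣ ℕ.≤ β →
         a < a′ → lexℤ β a u < lexℤ β a′ u′
lexℤ-< {β} {a} {a′} {u} {u′} ∣u∣≤β ∣u′∣≤β a<a′ = begin-strict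
  K * a + u             ≤⟨ ℤP.+-monoʳ-≤ (K * a) (ℤP.≤-trans (i≤+∣i∣ u) (ℤ.+≤+ ∣u∣≤β)) ⟩
  K * a + + β           <⟨ ℤP.+-monoʳ-< (K * a) (ℤ.+<+ (ℕP.n<1+n β)) ⟩
  K * a + + ℕ.suc β     ≡⟨ carry ⟩
  K * ℤ.suc a + - + β   ≤⟨ ℤP.+-mono-≤ (ℤP.*-monoˡ-≤-nonNeg K (ℤP.i<j⇒suc[i]≤j a<a′)) -β≤u′ ⟩
  K * a′ + u′           ∎
  where
  open ℤP.≤-Reasoning
  K = + ℕ.suc (β ℕ.+ β)
  -β≤u′ : - + β ≤ u′
  -β≤u′ = ℤP.≤-trans (ℤP.neg-mono-≤ (ℤ.+≤+ ∣u′∣≤β)) (-+∣i∣≤i u′)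
  carry : K * a + + ℕ.suc β ≡ K * ℤ.suc a + - + β
  carry rewrite ℤP.pos-+ 1 (β ℕ.+ β) | ℤP.pos-+ β β | ℤP.pos-+ 1 β = identity (+ β) a
    where
    identity : ∀ b a → (+ 1 + (b + b)) * a + (+ 1 + b) ≡ (+ 1 + (b + b)) * (+ 1 + a) + - b
    identity = solve-∀

lexℤ-injective : {β : ℕ} {a a′ u u′ : ℤ} → ∣ u ∣ ℕ.≤ β → ∣ u′ ∣ ℕ.≤ β →
                 lexℤ β a u ≡ lexℤ β a′ u′ → a ≡ a′ × u ≡ u′
lexℤ-injective {β} {a} {a′} ∣u∣≤β ∣u′∣≤β eq with ℤP.<-cmp a a′
... | tri< a<a′ _ _ = contradiction eq (ℤP.<⇒≢ (lexℤ-< ∣u∣≤β ∣u′∣≤β a<a′))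
... | tri> _ _ a′<a = contradiction (sym eq) (ℤP.<⇒≢ (lexℤ-< ∣u′∣≤β ∣u∣≤β a′<a))
... | tri≈ _ refl _ = refl , ∙-cancelˡ (+ ℕ.suc (β ℕ.+ β) * a) _ _ eq

lex : (φ ψ : Fin n → ℤ) → Fin n → ℤ
lex φ ψ j = + ℕ.suc (‖ ψ ‖ ℕ.+ ‖ ψ ‖) * φ j + ψ j

dot-lex : (φ ψ : Fin n → ℤ) (B : AdS n) → dot (lex φ ψ) B ≡ lexℤ ‖ ψ ‖ (dot φ B) (dot ψ B)
dot-lex φ ψ B = trans (dot-+ (λ j → K * φ j) ψ B) (cong (_+ dot ψ B) (dot-*ˡ K φ B))
  where K = + ℕ.suc (‖ ψ ‖ ℕ.+ ‖ ψ ‖)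

module _ (φ ψ : Fin n → ℤ) (B B′ : AdS n) where

  private
    K = + ℕ.suc (‖ ψ ‖ ℕ.+ ‖ ψ ‖)

    via-lexℤ : (R : ℤ → ℤ → Set) →
               R (lexℤ ‖ ψ ‖ (dot φ B) (dot ψ B)) (lexℤ ‖ ψ ‖ (dot φ B′) (dot ψ B′)) →
               R (dot (lex φ ψ) B) (dot (lex φ ψ) B′)
    via-lexℤ R = subst₂ R (sym (dot-lex φ ψ B)) (sym (dot-lex φ ψ B′))

  lex-< : dot φ B < dot φ B′ → dot (lex φ ψ) B < dot (lex φ ψ) B′
  lex-< φ< = via-lexℤ _<_ (lexℤ-< (∣dot∣≤‖‖ ψ B) (∣dot∣≤‖‖ ψ B′) φ<)

  lex-<ʳ : dot φ B ≡ dot φ B′ → dot ψ B < dot ψ B′ → dot (lex φ ψ) B < dot (lex φ ψ) B′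
  lex-<ʳ φ≡ ψ< = via-lexℤ _<_ (subst (λ a → K * dot φ B + dot ψ B < K * a + dot ψ B′) φ≡
                                     (ℤP.+-monoʳ-< (K * dot φ B) ψ<))

  lex-≤ʳ : dot φ B ≡ dot φ B′ → dot ψ B ≤ dot ψ B′ → dot (lex φ ψ) B ≤ dot (lex φ ψ) B′
  lex-≤ʳ φ≡ ψ≤ = via-lexℤ _≤_ (subst (λ a → K * dot φ B + dot ψ B ≤ K * a + dot ψ B′) φ≡
                                     (ℤP.+-monoʳ-≤ (K * dot φ B) ψ≤))

  lex-injectiveʳ : dot (lex φ ψ) B ≡ dot (lex φ ψ) B′ → dot ψ B ≡ dot ψ B′
  lex-injectiveʳ eq = proj₂ (lexℤ-injective {a = dot φ B} {a′ = dot φ B′}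
                               (∣dot∣≤‖‖ ψ B) (∣dot∣≤‖‖ ψ B′)
                               (trans (sym (dot-lex φ ψ B)) (trans eq (dot-lex φ ψ B′))))

module _ (φ ψ : Fin n → ℤ) (B B′ : AdS n) where

  lex-≤⇒≤ : dot (lex φ ψ) B ≤ dot (lex φ ψ) B′ → dot φ B ≤ dot φ B′
  lex-≤⇒≤ lex≤ = ℤP.≮⇒≥ (λ φ> → ℤP.<⇒≱ (lex-< φ ψ B′ B φ>) lex≤)

  lex-≤⇒≤ʳ : dot φ B ≡ dot φ B′ → dot (lex φ ψ) B ≤ dot (lex φ ψ) B′ → dot ψ B ≤ dot ψ B′
  lex-≤⇒≤ʳ φ≡ lex≤ = ℤP.≮⇒≥ (λ ψ> → ℤP.<⇒≱ (lex-<ʳ φ ψ B′ B (sym φ≡) ψ>) lex≤)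

  lex-mono-≤ : dot φ B ≤ dot φ B′ → dot ψ B ≤ dot ψ B′ → dot (lex φ ψ) B ≤ dot (lex φ ψ) B′
  lex-mono-≤ φ≤ ψ≤ with ℤP.<-cmp (dot φ B) (dot φ B′)
  ... | tri< φ< _ _ = ℤP.<⇒≤ (lex-< φ ψ B B′ φ<)
  ... | tri≈ _ φ≡ _ = lex-≤ʳ φ ψ B B′ φ≡ ψ≤
  ... | tri> _ _ φ> = contradiction φ≤ (ℤP.<⇒≱ φ>)

Full : AdS n → Set
Full B = ∀ i → B i ≢ nothing

separating : (n : ℕ) → Fin n → ℤ
separating (ℕ.suc n) zero    = + ℕ.suc (‖ separating n ‖ ℕ.+ ‖ separating n ‖)
separating (ℕ.suc n) (suc j) = separating n j

eVec-injective : (B B′ : AdS n) (i : Fin n) → B i ≢ nothing → B′ i ≢ nothing →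
                 eVec B i ≡ eVec B′ i → B i ≡ B′ i
eVec-injective B B′ i B≢ B′≢ eq with B i | B′ i
... | just true  | just true  = refl
... | just false | just false = refl
... | nothing    | _          = contradiction refl B≢
... | _          | nothing    = contradiction refl B′≢

separating-injective : {B B′ : AdS n} → Full B → Full B′ →
                       dot (separating n) B ≡ dot (separating n) B′ → SameSet B B′
separating-injective {ℕ.suc n} {B} {B′} full full′ eq i
  with lexℤ-injective {a = eVec B zero} {a′ = eVec B′ zero}
         (∣dot∣≤‖‖ (separating n) (B ∘ suc)) (∣dot∣≤‖‖ (separating n) (B′ ∘ suc)) eq
... | first , rest with i
...   | zero  = eVec-injective B B′ zero (full zero) (full′ zero) first
...   | suc j = separating-injective (full ∘ suc) (full′ ∘ suc) rest j

maxℤ : List ℤ → ℤ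
maxℤ []       = + 0
maxℤ (v ∷ vs) = foldr _⊔_ v vs

v≤maxℤ : {v : ℤ} {vs : List ℤ} → v ∈ vs → v ≤ maxℤ vs
v≤maxℤ {v} {w ∷ ws} v∈ = foldr-preservesᵒ {P = v ≤_} ≤-⊔ w ws (from v∈)
  where
  ≤-⊔ : ∀ x y → v ≤ x ⊎ v ≤ y → v ≤ x ⊔ y
  ≤-⊔ x y = [ (λ v≤x → ℤP.≤-trans v≤x (ℤP.i≤i⊔j x y)) , (λ v≤y → ℤP.≤-trans v≤y (ℤP.i≤j⊔i x y)) ]
  from : v ∈ w ∷ ws → v ≤ w ⊎ Any.Any (v ≤_) ws
  from (here v≡w)  = inj₁ (ℤP.≤-reflexive v≡w)
  from (there v∈′) = inj₂ (Any.map ℤP.≤-reflexive v∈′)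

maxℤ∈ : {v : ℤ} {vs : List ℤ} → v ∈ vs → maxℤ vs ∈ vs
maxℤ∈ {vs = w ∷ ws} _ with foldr-selective ℤP.⊔-sel w ws
... | inj₁ max≡w  = here max≡w
... | inj₂ max∈ws = there max∈ws

rankL≡maxℤ : (L : List (AdS n)) (S : AdS n) → rankL L S ≡ maxℤ (map (rankTerm S) L)
rankL≡maxℤ []       S = refl
rankL≡maxℤ (B ∷ Bs) S = sym (foldr-map _⊔_ (rankTerm S) (rankTerm S B) Bs)

module _ {L : List (AdS n)} {S : AdS n} where

  rankTerm≤rankL : {B : AdS n} → B ∈ L → rankTerm S B ≤ rankL L S
  rankTerm≤rankL B∈ = subst (_ ≤_) (sym (rankL≡maxℤ L S)) (v≤maxℤ (∈-map⁺ (rankTerm S) B∈))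

  rankL-attained : {B : AdS n} → B ∈ L → ∃ λ B′ → B′ ∈ L × rankTerm S B′ ≡ rankL L S
  rankL-attained B∈ with ∈-map⁻ (rankTerm S) (maxℤ∈ (∈-map⁺ (rankTerm S) B∈))
  ... | B′ , B′∈ , eq = B′ , B′∈ , sym (trans (rankL≡maxℤ L S) eq)

  rankL≡v⁺ : {B : AdS n} {v : ℤ} → B ∈ L → rankTerm S B ≡ v →
             (∀ {B′} → B′ ∈ L → rankTerm S B′ ≤ v) → rankL L S ≡ v
  rankL≡v⁺ B∈ attained bounded with rankL-attained B∈
  ... | B′ , B′∈ , eq = ℤP.≤-antisym (subst (_≤ _) eq (bounded B′∈))
                                     (subst (_≤ rankL L S) attained (rankTerm≤rankL B∈))

rankL-shift : {L : List (AdS n)} {S S′ : AdS n} {k : ℤ} {B₀ : AdS n} → B₀ ∈ L →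
              (∀ {B} → B ∈ L → rankTerm S′ B ≡ rankTerm S B + k) → rankL L S′ ≡ rankL L S + k
rankL-shift {L = L} {S} {S′} {k} B₀∈ shift with rankL-attained {S = S} B₀∈
... | B , B∈ , attains = rankL≡v⁺ B∈ (trans (shift B∈) (cong (_+ k) attains)) bounded
  where
  bounded : ∀ {B′} → B′ ∈ L → rankTerm S′ B′ ≤ rankL L S + k
  bounded B′∈ = subst (_≤ rankL L S + k) (sym (shift B′∈))
                      (ℤP.+-monoˡ-≤ k (rankTerm≤rankL {S = S} B′∈))

rankL-cong : (L : List (AdS n)) {S S′ : AdS n} → SameSet S S′ → rankL L S ≡ rankL L S′
rankL-cong L {S} {S′} S≗S′ = trans (rankL≡maxℤ L S)
  (trans (cong maxℤ (map-cong (rankTerm-congˡ S≗S′) L)) (sym (rankL≡maxℤ L S′)))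

≤-by-computation : {i j : ℤ} {i≤?j : True (i ℤ.≤? j)} → i ≤ j
≤-by-computation {i≤?j = i≤?j} = toWitness i≤?j

exchange-coordinate : (V p q : AdS n) (j : Fin n) →
  eVec V j * eVec p j ≤ eVec V j * eVec q j + + 2 * indicator (is-just (V j) ∧ differ (p j) (q j))
exchange-coordinate V p q j with V j | p j | q j
... | nothing    | _          | _          = ℤP.≤-refl
... | just true  | just true  | just true  = ≤-by-computation
... | just true  | just true  | just false = ≤-by-computation
... | just true  | just true  | nothing    = ≤-by-computation
... | just true  | just false | just true  = ≤-by-computation
... | just true  | just false | just false = ≤-by-computation
... | just true  | just false | nothing    = ≤-by-computation
... | just true  | nothing    | just true  = ≤-by-computation
... | just true  | nothing    | just false = ≤-by-computation
... | just true  | nothing    | nothing    = ≤-by-computation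
... | just false | just true  | just true  = ≤-by-computation
... | just false | just true  | just false = ≤-by-computation
... | just false | just true  | nothing    = ≤-by-computation
... | just false | just false | just true  = ≤-by-computation
... | just false | just false | just false = ≤-by-computation
... | just false | just false | nothing    = ≤-by-computation
... | just false | nothing    | just true  = ≤-by-computation
... | just false | nothing    | just false = ≤-by-computation
... | just false | nothing    | nothing    = ≤-by-computation

dist≤2⇒rankTerm≤+2 : (V p q : AdS n) (x : Fin n) → V x ≡ nothing → differ (p x) (q x) ≡ true →
                     dist p q ℕ.≤ 2 → rankTerm V p ≤ rankTerm V q + + 2
dist≤2⇒rankTerm≤+2 V p q x Vx differs dist≤2 = begin
  rankTerm V p                                              ≡⟨ rankTerm≡dot V p ⟩
  dot (eVec V) p                                            ≤⟨ sumℤ-mono-≤ (exchange-coordinate V p q) ⟩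
  sumℤ (λ j → eVec V j * eVec q j + + 2 * indicator (w j))  ≡⟨ split ⟩
  dot (eVec V) q + + 2 * sumℤ (indicator ∘ w)
    ≡⟨ cong₂ (λ a b → a + + 2 * b) (sym (rankTerm≡dot V q)) (sumℤ-indicator w) ⟩
  rankTerm V q + + 2 * + count w
    ≤⟨ ℤP.+-monoʳ-≤ (rankTerm V q) (ℤP.*-monoˡ-≤-nonNeg (+ 2) (ℤ.+≤+ count-w≤1)) ⟩
  rankTerm V q + + 2                                        ∎
  where
  open ℤP.≤-Reasoning
  w : Fin _ → Bool
  w j = is-just (V j) ∧ differ (p j) (q j)
  split : sumℤ (λ j → eVec V j * eVec q j + + 2 * indicator (w j))
          ≡ dot (eVec V) q + + 2 * sumℤ (indicator ∘ w)
  split = trans (sumℤ-+ (λ j → eVec V j * eVec q j) (λ j → + 2 * indicator (w j)))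
                (cong (_+_ (dot (eVec V) q)) (sumℤ-*ˡ (+ 2) (indicator ∘ w)))
  w⇒differ : ∀ j → w j ≡ true → differ (p j) (q j) ≡ true
  w⇒differ j = ∧-true-right (is-just (V j))
    where
    ∧-true-right : ∀ a {b} → a ∧ b ≡ true → b ≡ true
    ∧-true-right true  b≡true = b≡true
    ∧-true-right false ()
  count-w≤1 : count w ℕ.≤ 1
  count-w≤1 = ℕP.≤-pred (ℕP.≤-trans
    (count-< x w⇒differ (cong (λ m → is-just m ∧ differ (p x) (q x)) Vx) differs) dist≤2)

Disjoint : AdS n → AdS n → Set
Disjoint S T = ∀ i → S i ≡ nothing ⊎ T i ≡ nothing

∪ₐ-<∣> : (S T : AdS n) (i : Fin n) → (S ∪ₐ T) i ≡ S i <∣> T i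
∪ₐ-<∣> S T i with S i
... | just _  = refl
... | nothing = refl

∪ₐ-assoc : (S T R : AdS n) → SameSet ((S ∪ₐ T) ∪ₐ R) (S ∪ₐ (T ∪ₐ R))
∪ₐ-assoc S T R i
  rewrite ∪ₐ-<∣> (S ∪ₐ T) R i | ∪ₐ-<∣> S T i | ∪ₐ-<∣> S (T ∪ₐ R) i | ∪ₐ-<∣> T R i with S i
... | just _  = refl
... | nothing = refl

∪ₐ-congʳ : (S : AdS n) {T T′ : AdS n} → SameSet T T′ → SameSet (S ∪ₐ T) (S ∪ₐ T′)
∪ₐ-congʳ S {T} {T′} T≗T′ i =
  trans (∪ₐ-<∣> S T i) (trans (cong (S i <∣>_) (T≗T′ i)) (sym (∪ₐ-<∣> S T′ i)))

∪ₐ-identityʳ : (S : AdS n) {T : AdS n} → (∀ i → T i ≡ nothing) → SameSet (S ∪ₐ T) S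
∪ₐ-identityʳ S {T} T≗∅ i rewrite ∪ₐ-<∣> S T i | T≗∅ i with S i
... | just _  = refl
... | nothing = refl

erase-≢ : {x j : Fin n} (T : AdS n) → x ≢ j → erase x T j ≡ T j
erase-≢ {x = x} {j} T x≢j with eqFin x j in x≟j
... | true  = contradiction (eqFin-sound x j x≟j) x≢j
... | false = refl

erase-self : (x : Fin n) (T : AdS n) → erase x T x ≡ nothing
erase-self x T rewrite eqFin-refl x = refl

erase-nothing : {x : Fin n} {T : AdS n} → T x ≡ nothing → SameSet (erase x T) T
erase-nothing {x = x} {T} Tx j with eqFin x j in x≟j
... | true  = trans (sym Tx) (cong T (eqFin-sound x j x≟j))
... | false = refl

erase-∪-singleton : (x : Fin n) (T : AdS n) → SameSet (erase x T ∪ₐ [ x ↦ T x ]) T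
erase-∪-singleton x T j rewrite ∪ₐ-<∣> (erase x T) [ x ↦ T x ] j with eqFin x j in x≟j
... | true  = cong T (eqFin-sound x j x≟j)
... | false with T j
...   | just _  = refl
...   | nothing = refl

disjoint-singleton : {V : AdS n} {x : Fin n} (m : Maybe Bool) → V x ≡ nothing → Disjoint V [ x ↦ m ]
disjoint-singleton {V = V} {x} m Vx i with eqFin x i in x≟i
... | true  = inj₁ (subst (λ j → V j ≡ nothing) (eqFin-sound x i x≟i) Vx)
... | false = inj₂ refl

rankTerm-∅ : {T : AdS n} → (∀ i → T i ≡ nothing) → (B : AdS n) → rankTerm T B ≡ + 0
rankTerm-∅ {n} T≗∅ B =
  trans (rankTerm-congˡ {S′ = ∅ₐ} T≗∅ B) (trans (rankTerm≡dot ∅ₐ B) (sumℤ-zero {n} (λ _ → refl)))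

rankTerm-∪ : {S T : AdS n} → Disjoint S T → (B : AdS n) →
             rankTerm (S ∪ₐ T) B ≡ rankTerm S B + rankTerm T B
rankTerm-∪ {S = S} {T} disjoint B = begin
  rankTerm (S ∪ₐ T) B               ≡⟨ rankTerm-congˡ (∪ₐ-<∣> S T) B ⟩
  rankTerm (λ i → S i <∣> T i) B    ≡⟨ rankTerm≡dot _ B ⟩
  dot (eVec (λ i → S i <∣> T i)) B  ≡⟨ sumℤ-cong (λ i → cong (_* eVec B i) (eVec-<∣> i (disjoint i))) ⟩
  dot (λ i → eVec S i + eVec T i) B ≡⟨ dot-+ (eVec S) (eVec T) B ⟩
  dot (eVec S) B + dot (eVec T) B   ≡⟨ sym (cong₂ _+_ (rankTerm≡dot S B) (rankTerm≡dot T B)) ⟩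
  rankTerm S B + rankTerm T B       ∎
  where
  open ≡-Reasoning
  eVec-<∣> : ∀ i → S i ≡ nothing ⊎ T i ≡ nothing → eVec (λ j → S j <∣> T j) i ≡ eVec S i + eVec T i
  eVec-<∣> i disjointᵢ with S i | T i
  ... | nothing    | just true  = refl
  ... | nothing    | just false = refl
  ... | nothing    | nothing    = refl
  ... | just true  | nothing    = refl
  ... | just false | nothing    = refl
  ... | just _     | just _     with disjointᵢ
  ...   | inj₁ ()
  ...   | inj₂ ()

rankTerm-∪-singleton : {V : AdS n} {x : Fin n} (m : Maybe Bool) → V x ≡ nothing → (B : AdS n) →
                       rankTerm (V ∪ₐ [ x ↦ m ]) B ≡ rankTerm V B + rankTerm [ x ↦ m ] B
rankTerm-∪-singleton m Vx = rankTerm-∪ (disjoint-singleton m Vx)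

anyᵇ-true : {A : Set} (p : A → Bool) (xs : List A) → anyᵇ p xs ≡ true → ∃ λ x → x ∈ xs × p x ≡ true
anyᵇ-true p (y ∷ ys) any with p y in py
... | true  = y , here refl , py
... | false with anyᵇ-true p ys any
...   | x , x∈ , px = x , there x∈ , px

anyᵇ-false : {A : Set} (p : A → Bool) (xs : List A) → anyᵇ p xs ≡ false →
             ∀ {x} → x ∈ xs → p x ≡ false
anyᵇ-false p (y ∷ ys) any x∈ with p y in py
anyᵇ-false p (y ∷ ys) ()  x∈          | true
anyᵇ-false p (y ∷ ys) any (here refl) | false = py
anyᵇ-false p (y ∷ ys) any (there x∈)  | false = anyᵇ-false p ys any x∈

∈-filterᵇ⁺ : {A : Set} (p : A → Bool) {x : A} {xs : List A} → x ∈ xs → p x ≡ true → x ∈ filterᵇ p xs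
∈-filterᵇ⁺ p x∈ px = ∈-filter⁺ (T? ∘ p) x∈ (Equivalence.from T-≡ px)

∈-filterᵇ⁻ : {A : Set} (p : A → Bool) (xs : List A) {x : A} → x ∈ filterᵇ p xs → x ∈ xs × p x ≡ true
∈-filterᵇ⁻ p xs x∈ with ∈-filter⁻ (T? ∘ p) x∈
... | x∈xs , px = x∈xs , Equivalence.to T-≡ px

hasSign⇒≡just : (σ : Bool) {m : Maybe Bool} → hasSign σ m ≡ true → m ≡ just σ
hasSign⇒≡just true  {just true}  _ = refl
hasSign⇒≡just false {just false} _ = refl

≡just⇒hasSign : (σ : Bool) {m : Maybe Bool} → m ≡ just σ → hasSign σ m ≡ true
≡just⇒hasSign true  refl = refl
≡just⇒hasSign false refl = refl

just-or-just : (σ : Bool) {m : Maybe Bool} → m ≢ nothing → m ≡ just σ ⊎ m ≡ just (not σ)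
just-or-just true  {just true}  _ = inj₁ refl
just-or-just true  {just false} _ = inj₂ refl
just-or-just false {just true}  _ = inj₂ refl
just-or-just false {just false} _ = inj₁ refl
just-or-just σ     {nothing}    m≢nothing = contradiction refl m≢nothing

¬hasSign⇒≡just-not : (σ : Bool) {m : Maybe Bool} → m ≢ nothing → hasSign σ m ≡ false →
                     m ≡ just (not σ)
¬hasSign⇒≡just-not σ m≢nothing ¬hasSign with just-or-just σ m≢nothing
... | inj₂ m≡ = m≡
... | inj₁ m≡ = contradiction (trans (sym ¬hasSign) (≡just⇒hasSign σ m≡)) λ ()

hasSignAt : Bool → Fin n → AdS n → Bool
hasSignAt σ x B = hasSign σ (B x)

-- minor1 σ x without the erasure of coordinate x, so the selected sets stay feasible sets of D.
select : Bool → Fin n → List (AdS n) → List (AdS n)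
select σ x L = if anyᵇ (hasSignAt σ x) L then filterᵇ (hasSignAt σ x) L else L

selectAt : Maybe Bool → Fin n → List (AdS n) → List (AdS n)
selectAt nothing  x L = L
selectAt (just σ) x L = select σ x L

selectAll : AdS n → List (Fin n) → List (AdS n) → List (AdS n)
selectAll T xs L = foldl (λ L′ x → selectAt (T x) x L′) L xs

selectAll-cong : {T T′ : AdS n} (xs : List (Fin n)) → (∀ {y} → y ∈ xs → T y ≡ T′ y) →
                 (L : List (AdS n)) → selectAll T xs L ≡ selectAll T′ xs L
selectAll-cong []       T≗T′ L = refl
selectAll-cong {T = T} {T′} (y ∷ ys) T≗T′ L =
  trans (cong (λ m → selectAll T ys (selectAt m y L)) (T≗T′ (here refl)))
        (selectAll-cong ys (T≗T′ ∘ there) (selectAt (T′ y) y L))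

-- Faces of the polytope of D

module _ (D : DeltaMatroid n) where

  Maximizes : (Fin n → ℤ) → AdS n → Set
  Maximizes φ B = ∀ {B′} → B′ ∈ feasible D → dot φ B′ ≤ dot φ B

  record Face (L : List (AdS n)) : Set where
    field
      normal   : Fin n → ℤ
      members  : ∀ {B} → B ∈ L ⇔ (B ∈ feasible D × Maximizes normal B)
      nonempty : ∃ (_∈ L)

    feasible-of : ∀ {B} → B ∈ L → B ∈ feasible D
    feasible-of = proj₁ ∘ Equivalence.to members

    maximizes-of : ∀ {B} → B ∈ L → Maximizes normal B
    maximizes-of = proj₂ ∘ Equivalence.to members

    member-of : ∀ {B} → B ∈ feasible D → Maximizes normal B → B ∈ L
    member-of B∈ max = Equivalence.from members (B∈ , max)

    full-of : ∀ {B} → B ∈ L → Full B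
    full-of = full D _ ∘ feasible-of

  open Face

  feasible-face : Face (feasible D)
  feasible-face = record
    { normal   = λ _ → + 0
    ; members  = λ {B} → mk⇔ (λ B∈ → B∈ , λ {B′} _ → ℤP.≤-reflexive (trans (dot-zero B′) (sym (dot-zero B))))
                            proj₁
    ; nonempty = nonempty D
    }
    where
    dot-zero : ∀ B → dot (λ _ → + 0) B ≡ + 0
    dot-zero _ = sumℤ-zero {n} (λ _ → refl)

  select-face : (σ : Bool) (x : Fin n) {L : List (AdS n)} → Face L → Face (select σ x L)
  select-face σ x {L} face with anyᵇ (hasSignAt σ x) L in any
  ... | false = face
  ... | true with anyᵇ-true (hasSignAt σ x) L any
  ...   | B₀ , B₀∈ , B₀σ = record
    { normal   = lex φ τ
    ; members  = mk⇔ to from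
    ; nonempty = B₀ , ∈-filterᵇ⁺ (hasSignAt σ x) B₀∈ B₀σ
    }
    where
    φ = normal face
    τ = eVec [ x ↦ just σ ]

    to : ∀ {B} → B ∈ filterᵇ (hasSignAt σ x) L → B ∈ feasible D × Maximizes (lex φ τ) B
    to {B} B∈ with ∈-filterᵇ⁻ (hasSignAt σ x) L B∈
    ... | B∈L , Bσ = feasible-of face B∈L , λ {B′} B′∈ →
      lex-mono-≤ φ τ B′ B (maximizes-of face B∈L B′∈)
        (ℤP.≤-trans (dot-singleton-≤1 x σ B′)
                    (ℤP.≤-reflexive (sym (dot-singleton-agree x σ B (hasSign⇒≡just σ Bσ)))))

    from : ∀ {B} → B ∈ feasible D × Maximizes (lex φ τ) B → B ∈ filterᵇ (hasSignAt σ x) L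
    from {B} (B∈F , max) = ∈-filterᵇ⁺ (hasSignAt σ x) (member-of face B∈F maxφ) Bσ
      where
      maxφ : Maximizes φ B
      maxφ {B′} B′∈ = lex-≤⇒≤ φ τ B′ B (max B′∈)
      B₀∈F = feasible-of face B₀∈
      τ≤ : dot τ B₀ ≤ dot τ B
      τ≤ = lex-≤⇒≤ʳ φ τ B₀ B (ℤP.≤-antisym (maxφ B₀∈F) (maximizes-of face B₀∈ B∈F)) (max B₀∈F)
      Bσ : hasSignAt σ x B ≡ true
      Bσ with just-or-just σ (full D B B∈F x)
      ... | inj₁ Bx = ≡just⇒hasSign σ Bx
      ... | inj₂ Bx = contradiction (subst₂ _≤_ (dot-singleton-agree x σ B₀ (hasSign⇒≡just σ B₀σ))
                                                (dot-singleton-disagree x σ B Bx) τ≤) λ ()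

  -- 2Ψ + (Ψ p − Ψ q) e_x^σ takes its maximum exactly at p and q, so {e_p, e_q} is an edge.
  maximizers-dist≤2 : (Ψ : Fin n → ℤ) (x : Fin n) (σ : Bool) {p q : AdS n} →
                      p ∈ feasible D → q ∈ feasible D → p x ≡ just (not σ) → q x ≡ just σ →
                      (∀ {B} → B ∈ feasible D → B x ≡ just (not σ) → ¬ SameSet B p → dot Ψ B < dot Ψ p) →
                      (∀ {B} → B ∈ feasible D → B x ≡ just σ → ¬ SameSet B q → dot Ψ B < dot Ψ q) →
                      dist p q ℕ.≤ 2
  maximizers-dist≤2 Ψ x σ {p} {q} p∈ q∈ px qx p-top q-top =
    edges D p q p∈ q∈ (c , c[p]≡c[q] , below)
    where
    τ = eVec [ x ↦ just σ ]
    k = dot Ψ p - dot Ψ q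
    c : Fin n → ℤ
    c j = (Ψ j + Ψ j) + k * τ j

    dot-c : ∀ B → dot c B ≡ (dot Ψ B + dot Ψ B) + k * dot τ B
    dot-c B = trans (dot-+ (λ j → Ψ j + Ψ j) (λ j → k * τ j) B)
                    (cong₂ _+_ (dot-+ Ψ Ψ B) (dot-*ˡ k τ B))

    c-agree : ∀ B → B x ≡ just σ → dot c B ≡ (dot Ψ B + dot Ψ B) + k * + 1
    c-agree B Bx = trans (dot-c B)
                         (cong (λ t → (dot Ψ B + dot Ψ B) + k * t) (dot-singleton-agree x σ B Bx))

    c-disagree : ∀ B → B x ≡ just (not σ) → dot c B ≡ (dot Ψ B + dot Ψ B) + k * - + 1
    c-disagree B Bx = trans (dot-c B)
                            (cong (λ t → (dot Ψ B + dot Ψ B) + k * t) (dot-singleton-disagree x σ B Bx))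

    c[p]≡c[q] : dot c p ≡ dot c q
    c[p]≡c[q] = trans (c-disagree p px) (trans (balance (dot Ψ p) (dot Ψ q)) (sym (c-agree q qx)))
      where
      balance : ∀ a b → (a + a) + (a - b) * - + 1 ≡ (b + b) + (a - b) * + 1
      balance = solve-∀

    below : ∀ B → B ∈ feasible D → ¬ SameSet B p → ¬ SameSet B q → dot c B < dot c p
    below B B∈ B≉p B≉q with just-or-just σ (full D B B∈ x)
    ... | inj₁ Bx = subst₂ _<_ (sym (c-agree B Bx)) (trans (sym (c-agree q qx)) (sym c[p]≡c[q]))
                      (ℤP.+-monoˡ-< (k * + 1) (ℤP.+-mono-< (q-top B∈ Bx B≉q) (q-top B∈ Bx B≉q)))
    ... | inj₂ Bx = subst₂ _<_ (sym (c-disagree B Bx)) (sym (c-disagree p px))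
                      (ℤP.+-monoˡ-< (k * - + 1) (ℤP.+-mono-< (p-top B∈ Bx B≉p) (p-top B∈ Bx B≉p)))

  module _ {L : List (AdS n)} (face : Face L) (V : AdS n) where

    tiebreak : Fin n → ℤ
    tiebreak = lex (normal face) (lex (eVec V) (separating n))

    record Optimal (x : Fin n) (s : Bool) (r : AdS n) : Set where
      field
        member  : r ∈ L
        sign-at : r x ≡ just s
        maximal : ∀ {B} → B ∈ L → B x ≡ just s → rankTerm V B ≤ rankTerm V r
        unique  : ∀ {B} → B ∈ feasible D → B x ≡ just s → ¬ SameSet B r →
                  dot tiebreak B < dot tiebreak r

    optimal : (x : Fin n) (s : Bool) {B₀ : AdS n} → B₀ ∈ L → B₀ x ≡ just s → ∃ (Optimal x s)
    optimal x s {B₀} B₀∈ B₀x = r , record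
      { member  = member-of face r∈F r-maximizes
      ; sign-at = hasSign⇒≡just s (proj₂ (∈-filterᵇ⁻ (hasSignAt s x) (feasible D) r∈C))
      ; maximal = maximal
      ; unique  = unique
      }
      where
      φ = normal face
      W = lex (eVec V) (separating n)
      C = filterᵇ (hasSignAt s x) (feasible D)

      candidate : ∀ {B} → B ∈ feasible D → B x ≡ just s → B ∈ C
      candidate B∈ Bx = ∈-filterᵇ⁺ (hasSignAt s x) B∈ (≡just⇒hasSign s Bx)

      r = argmax (dot tiebreak) B₀ C

      r∈C : r ∈ C
      r∈C with argmax-sel (dot tiebreak) B₀ C
      ... | inj₁ r≡B₀ = subst (_∈ C) (sym r≡B₀) (candidate (feasible-of face B₀∈) B₀x)
      ... | inj₂ r∈C′ = r∈C′

      r∈F = proj₁ (∈-filterᵇ⁻ (hasSignAt s x) (feasible D) r∈C)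

      r-top : ∀ {B} → B ∈ C → dot tiebreak B ≤ dot tiebreak r
      r-top = All.lookup (f[xs]≤f[argmax] B₀ C)

      r-maximizes : Maximizes φ r
      r-maximizes B′∈ = ℤP.≤-trans (maximizes-of face B₀∈ B′∈)
        (lex-≤⇒≤ φ W B₀ r (r-top (candidate (feasible-of face B₀∈) B₀x)))

      maximal : ∀ {B} → B ∈ L → B x ≡ just s → rankTerm V B ≤ rankTerm V r
      maximal {B} B∈ Bx = subst₂ _≤_ (sym (rankTerm≡dot V B)) (sym (rankTerm≡dot V r))
        (lex-≤⇒≤ (eVec V) (separating n) B r
          (lex-≤⇒≤ʳ φ W B r φ-tied (r-top (candidate (feasible-of face B∈) Bx))))
        where
        φ-tied : dot φ B ≡ dot φ r
        φ-tied = ℤP.≤-antisym (r-maximizes (feasible-of face B∈)) (maximizes-of face B∈ r∈F)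

      unique : ∀ {B} → B ∈ feasible D → B x ≡ just s → ¬ SameSet B r → dot tiebreak B < dot tiebreak r
      unique {B} B∈ Bx B≉r = ℤP.≤∧≢⇒< (r-top (candidate B∈ Bx)) λ tied →
        B≉r (separating-injective (full D B B∈) (full D r r∈F)
              (lex-injectiveʳ (eVec V) (separating n) B r (lex-injectiveʳ φ W B r tied)))

    open Optimal

    opposite≤optimal+2 : (x : Fin n) (σ : Bool) → V x ≡ nothing → {q : AdS n} → Optimal x σ q →
                         ∀ {B} → B ∈ L → B x ≡ just (not σ) → rankTerm V B ≤ rankTerm V q + + 2
    opposite≤optimal+2 x σ Vx {q} q-opt {B} B∈ Bx =
      ℤP.≤-trans (maximal p-opt B∈ Bx) (dist≤2⇒rankTerm≤+2 V p q x Vx differs dist≤2)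
      where
      p = proj₁ (optimal x (not σ) B∈ Bx)
      p-opt = proj₂ (optimal x (not σ) B∈ Bx)
      dist≤2 : dist p q ℕ.≤ 2
      dist≤2 = maximizers-dist≤2 tiebreak x σ
                 (feasible-of face (member p-opt)) (feasible-of face (member q-opt))
                 (sign-at p-opt) (sign-at q-opt) (unique p-opt) (unique q-opt)
      differs : differ (p x) (q x) ≡ true
      differs = subst₂ (λ a b → differ a b ≡ true) (sym (sign-at p-opt)) (sym (sign-at q-opt))
                       (opposite σ)
        where
        opposite : ∀ σ → differ (just (not σ)) (just σ) ≡ true
        opposite true  = refl
        opposite false = refl

    rankL-select-none : (σ : Bool) (x : Fin n) → V x ≡ nothing →
                        (∀ {B} → B ∈ L → B x ≡ just (not σ)) →
                        rankL L V ≡ rankL L (V ∪ₐ [ x ↦ just σ ]) - rankL L [ x ↦ just σ ]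
    rankL-select-none σ x Vx opposite =
      trans (sym (m+k-k≡m (rankL L V) (- + 1))) (cong₂ _-_ (sym shifted) (sym constant))
      where
      B₀∈ = proj₂ (nonempty face)
      τ[_] : ∀ {B} → B ∈ L → rankTerm [ x ↦ just σ ] B ≡ - + 1
      τ[ B∈ ] = rankTerm-singleton-disagree x σ _ (opposite B∈)
      constant : rankL L [ x ↦ just σ ] ≡ - + 1
      constant = rankL≡v⁺ B₀∈ τ[ B₀∈ ] (ℤP.≤-reflexive ∘ τ[_])
      shifted : rankL L (V ∪ₐ [ x ↦ just σ ]) ≡ rankL L V + - + 1
      shifted = rankL-shift B₀∈ λ {B} B∈ →
        trans (rankTerm-∪-singleton (just σ) Vx B) (cong (_+_ (rankTerm V B)) τ[ B∈ ])

    rankL-select-some : (σ : Bool) (x : Fin n) → V x ≡ nothing → {B₀ : AdS n} → B₀ ∈ L → B₀ x ≡ just σ →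
                        rankL (filterᵇ (hasSignAt σ x) L) V
                          ≡ rankL L (V ∪ₐ [ x ↦ just σ ]) - rankL L [ x ↦ just σ ]
    rankL-select-some σ x Vx {B₀} B₀∈ B₀x =
      trans selected (trans (sym (m+k-k≡m (rankTerm V q) (+ 1))) (cong₂ _-_ (sym joint) (sym constant)))
      where
      q = proj₁ (optimal x σ B₀∈ B₀x)
      q-opt = proj₂ (optimal x σ B₀∈ B₀x)

      selected : rankL (filterᵇ (hasSignAt σ x) L) V ≡ rankTerm V q
      selected = rankL≡v⁺ (∈-filterᵇ⁺ (hasSignAt σ x) (member q-opt) (≡just⇒hasSign σ (sign-at q-opt)))
                          refl
        λ B∈ → let B∈L , Bσ = ∈-filterᵇ⁻ (hasSignAt σ x) L B∈ in maximal q-opt B∈L (hasSign⇒≡just σ Bσ)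

      constant : rankL L [ x ↦ just σ ] ≡ + 1
      constant = rankL≡v⁺ B₀∈ (rankTerm-singleton-agree x σ B₀ B₀x)
        λ {B} _ → subst (_≤ + 1) (sym (rankTerm≡dot _ B)) (dot-singleton-≤1 x σ B)

      joint : rankL L (V ∪ₐ [ x ↦ just σ ]) ≡ rankTerm V q + + 1
      joint = rankL≡v⁺ (member q-opt) (with-τ q (rankTerm-singleton-agree x σ q (sign-at q-opt))) bounded
        where
        with-τ : ∀ B {t} → rankTerm [ x ↦ just σ ] B ≡ t →
                 rankTerm (V ∪ₐ [ x ↦ just σ ]) B ≡ rankTerm V B + t
        with-τ B τB = trans (rankTerm-∪-singleton (just σ) Vx B) (cong (_+_ (rankTerm V B)) τB)
        bounded : ∀ {B} → B ∈ L → rankTerm (V ∪ₐ [ x ↦ just σ ]) B ≤ rankTerm V q + + 1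
        bounded {B} B∈ with just-or-just σ (full-of face B∈ x)
        ... | inj₁ Bx = subst (_≤ _) (sym (with-τ B (rankTerm-singleton-agree x σ B Bx)))
                          (ℤP.+-monoˡ-≤ (+ 1) (maximal q-opt B∈ Bx))
        ... | inj₂ Bx = subst₂ _≤_ (sym (with-τ B (rankTerm-singleton-disagree x σ B Bx)))
                          (ℤP.+-assoc (rankTerm V q) (+ 2) (- + 1))
                          (ℤP.+-monoˡ-≤ (- + 1) (opposite≤optimal+2 x σ Vx q-opt B∈ Bx))

    rankL-select : (σ : Bool) (x : Fin n) → V x ≡ nothing →
                   rankL (select σ x L) V ≡ rankL L (V ∪ₐ [ x ↦ just σ ]) - rankL L [ x ↦ just σ ]
    rankL-select σ x Vx with anyᵇ (hasSignAt σ x) L in any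
    ... | false = rankL-select-none σ x Vx λ B∈ →
                    ¬hasSign⇒≡just-not σ (full-of face B∈ x) (anyᵇ-false (hasSignAt σ x) L any B∈)
    ... | true with anyᵇ-true (hasSignAt σ x) L any
    ...   | B₀ , B₀∈ , B₀σ = rankL-select-some σ x Vx B₀∈ (hasSign⇒≡just σ B₀σ)

  selectAt-face : (m : Maybe Bool) (x : Fin n) {L : List (AdS n)} → Face L → Face (selectAt m x L)
  selectAt-face nothing  x face = face
  selectAt-face (just σ) x face = select-face σ x face

  rankL-selectAt : {L : List (AdS n)} → Face L → (x : Fin n) {T : AdS n} (U : AdS n) →
                   Disjoint U T → ∀ {m} → T x ≡ m →
                   rankL (selectAt m x L) (U ∪ₐ erase x T) - rankL (selectAt m x L) (erase x T)
                     ≡ rankL L (U ∪ₐ T) - rankL L T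
  rankL-selectAt {L} face x {T} U U⊥T {nothing} Tx =
    cong₂ _-_ (rankL-cong L (∪ₐ-congʳ U (erase-nothing Tx))) (rankL-cong L (erase-nothing Tx))
  rankL-selectAt {L} face x {T} U U⊥T {just σ} Tx = begin
    rankL (select σ x L) (U ∪ₐ T′) - rankL (select σ x L) T′
      ≡⟨ cong₂ _-_ (rankL-select face (U ∪ₐ T′) σ x U∪T′x) (rankL-select face T′ σ x (erase-self x T)) ⟩
    (rankL L ((U ∪ₐ T′) ∪ₐ [ x ↦ just σ ]) - c) - (rankL L (T′ ∪ₐ [ x ↦ just σ ]) - c)
      ≡⟨ cancel (rankL L ((U ∪ₐ T′) ∪ₐ [ x ↦ just σ ])) (rankL L (T′ ∪ₐ [ x ↦ just σ ])) c ⟩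
    rankL L ((U ∪ₐ T′) ∪ₐ [ x ↦ just σ ]) - rankL L (T′ ∪ₐ [ x ↦ just σ ])
      ≡⟨ cong₂ _-_ (rankL-cong L (λ i → trans (∪ₐ-assoc U T′ [ x ↦ just σ ] i) (∪ₐ-congʳ U reinsert i)))
                   (rankL-cong L reinsert) ⟩
    rankL L (U ∪ₐ T) - rankL L T ∎
    where
    open ≡-Reasoning
    T′ = erase x T
    c = rankL L [ x ↦ just σ ]
    reinsert : SameSet (T′ ∪ₐ [ x ↦ just σ ]) T
    reinsert = subst (λ m → SameSet (T′ ∪ₐ [ x ↦ m ]) T) Tx (erase-∪-singleton x T)
    U∪T′x : (U ∪ₐ T′) x ≡ nothing
    U∪T′x with U⊥T x
    ... | inj₁ Ux = trans (∪ₐ-<∣> U T′ x) (cong₂ _<∣>_ Ux (erase-self x T))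
    ... | inj₂ Tx′ = contradiction (trans (sym Tx) Tx′) λ ()
    cancel : ∀ a b c → (a - c) - (b - c) ≡ a - b
    cancel = solve-∀

  rankL-selectAll : (T : AdS n) (xs : List (Fin n)) → Unique xs → (∀ j → j ∉ xs → T j ≡ nothing) →
                    {L : List (AdS n)} → Face L → (U : AdS n) → Disjoint U T →
                    rankL (selectAll T xs L) U ≡ rankL L (U ∪ₐ T) - rankL L T
  rankL-selectAll T [] [] outside {L} face U U⊥T = sym (begin
    rankL L (U ∪ₐ T) - rankL L T ≡⟨ cong₂ _-_ (rankL-cong L (∪ₐ-identityʳ U empty)) empty-rank ⟩
    rankL L U - + 0              ≡⟨ ℤP.+-identityʳ (rankL L U) ⟩
    rankL L U                    ∎)
    where
    open ≡-Reasoning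
    empty : ∀ i → T i ≡ nothing
    empty i = outside i λ ()
    empty-rank : rankL L T ≡ + 0
    empty-rank = rankL≡v⁺ (proj₂ (nonempty face)) (rankTerm-∅ empty _)
                         (λ {B} _ → ℤP.≤-reflexive (rankTerm-∅ empty B))
  rankL-selectAll T (x ∷ xs) (x∉xs ∷ unique) outside {L} face U U⊥T = begin
    rankL (selectAll T xs L′) U
      ≡⟨ cong (λ L″ → rankL L″ U) (selectAll-cong xs T≗T′ L′) ⟩
    rankL (selectAll T′ xs L′) U
      ≡⟨ rankL-selectAll T′ xs unique outside′ (selectAt-face (T x) x face) U U⊥T′ ⟩
    rankL L′ (U ∪ₐ T′) - rankL L′ T′
      ≡⟨ rankL-selectAt face x U U⊥T refl ⟩
    rankL L (U ∪ₐ T) - rankL L T ∎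
    where
    open ≡-Reasoning
    T′ = erase x T
    L′ = selectAt (T x) x L
    T≗T′ : ∀ {y} → y ∈ xs → T y ≡ T′ y
    T≗T′ y∈ = sym (erase-≢ T (All.lookup x∉xs y∈))
    outside′ : ∀ j → j ∉ xs → T′ j ≡ nothing
    outside′ j j∉xs with x ≟ j
    ... | yes refl = erase-self x T
    ... | no x≢j   = trans (erase-≢ T x≢j)
                           (outside j λ { (here j≡x) → x≢j (sym j≡x) ; (there j∈) → j∉xs j∈ })
    U⊥T′ : Disjoint U T′
    U⊥T′ i with eqFin x i | U⊥T i
    ... | true  | _       = inj₂ refl
    ... | false | U⊥T[i] = U⊥T[i]

-- Erasing processed coordinates

anyᵇ-Pointwise : {A B : Set} {R : A → B → Set} {p : A → Bool} {q : B → Bool} →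
                 (∀ {a b} → R a b → p a ≡ q b) →
                 {as : List A} {bs : List B} → Pointwise R as bs → anyᵇ p as ≡ anyᵇ q bs
anyᵇ-Pointwise p≗q []       = refl
anyᵇ-Pointwise p≗q (r ∷ rs) = cong₂ (λ b c → if b then true else c) (p≗q r) (anyᵇ-Pointwise p≗q rs)

select-Pointwise : {R : AdS n → AdS n → Set} (σ : Bool) (x : Fin n) →
                   (∀ {B′ B} → R B′ B → B′ x ≡ B x) →
                   {L′ L : List (AdS n)} → Pointwise R L′ L → Pointwise R (select σ x L′) (select σ x L)
select-Pointwise {R = R} σ x same-at-x {L′} {L} L′~L = by-cases (anyᵇ-Pointwise sign-agrees L′~L)
  where
  sign-agrees : ∀ {B′ B} → R B′ B → hasSignAt σ x B′ ≡ hasSignAt σ x B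
  sign-agrees r = cong (hasSign σ) (same-at-x r)
  by-cases : anyᵇ (hasSignAt σ x) L′ ≡ anyᵇ (hasSignAt σ x) L →
             Pointwise R (select σ x L′) (select σ x L)
  by-cases same-any with anyᵇ (hasSignAt σ x) L′ | anyᵇ (hasSignAt σ x) L
  ... | true  | true  = Pointwise.filter⁺ (T? ∘ hasSignAt σ x) (T? ∘ hasSignAt σ x)
                          (λ r → subst T (sign-agrees r)) (λ r → subst T (sym (sign-agrees r))) L′~L
  ... | false | false = L′~L
  ... | true  | false = contradiction same-any λ ()
  ... | false | true  = contradiction same-any λ ()

minor1≡map-erase-select : (σ : Bool) (x : Fin n) (L : List (AdS n)) →
                          minor1 σ x L ≡ map (erase x) (select σ x L)
minor1≡map-erase-select σ x L with anyᵇ (hasSignAt σ x) L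
... | true  = refl
... | false = refl

minorAt : Maybe Bool → Fin n → List (AdS n) → List (AdS n)
minorAt nothing  x L = L
minorAt (just σ) x L = minor1 σ x L

minorL≡foldl-minorAt : (A B : Sub n) (F : List (AdS n)) →
                       minorL A B F ≡ foldl (λ L x → minorAt ((pos A ∪ₐ bar B) x) x L) F (allFin n)
minorL≡foldl-minorAt {n} A B F = foldl-cong step F (allFin n)
  where
  step : ∀ L x → (if A x then minor1 true x L else (if B x then minor1 false x L else L))
                 ≡ minorAt ((pos A ∪ₐ bar B) x) x L
  step L x = trans by-cases (cong (λ m → minorAt m x L) (sym (∪ₐ-<∣> (pos A) (bar B) x)))
    where
    by-cases : (if A x then minor1 true x L else (if B x then minor1 false x L else L))
               ≡ minorAt (pos A x <∣> bar B x) x L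
    by-cases with A x | B x
    ... | true  | _     = refl
    ... | false | true  = refl
    ... | false | false = refl

module _ (T : AdS n) where

  -- B′ may differ from B only at erased coordinates: these are processed, so not in xs, and lie in
  -- the domain of T.
  Agree : List (Fin n) → AdS n → AdS n → Set
  Agree xs B′ B = ∀ j → j ∈ xs ⊎ T j ≡ nothing → B′ j ≡ B j

  minorAt-Agree : (x : Fin n) {xs : List (Fin n)} → All.All (x ≢_) xs →
                  {L′ L : List (AdS n)} → Pointwise (Agree (x ∷ xs)) L′ L →
                  Pointwise (Agree xs) (minorAt (T x) x L′) (selectAt (T x) x L)
  minorAt-Agree x {xs} x∉xs {L′} {L} L′~L with T x in Tx
  ... | nothing = Pointwise.map (λ agree j → agree j ∘ map₁ there) L′~L
  ... | just σ  = subst₂ (Pointwise (Agree xs))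
                         (sym (minor1≡map-erase-select σ x L′)) (map-id (select σ x L))
                         (Pointwise.map⁺ (erase x) id (Pointwise.map erased selected))
    where
    selected : Pointwise (Agree (x ∷ xs)) (select σ x L′) (select σ x L)
    selected = select-Pointwise σ x (λ agree → agree x (inj₁ (here refl))) L′~L
    erased : ∀ {B′ B} → Agree (x ∷ xs) B′ B → Agree xs (erase x B′) B
    erased {B′} agree j j-free with eqFin x j in x≟j
    ... | false = agree j (map₁ there j-free)
    ... | true with eqFin-sound x j x≟j | j-free
    ...   | refl | inj₁ x∈xs = contradiction refl (All.lookup x∉xs x∈xs)
    ...   | refl | inj₂ Tx≡nothing = contradiction (trans (sym Tx) Tx≡nothing) λ ()

  minorAt-foldl-Agree : (xs : List (Fin n)) → Unique xs →
                        {L′ L : List (AdS n)} → Pointwise (Agree xs) L′ L →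
                        Pointwise (Agree []) (foldl (λ L″ x → minorAt (T x) x L″) L′ xs) (selectAll T xs L)
  minorAt-foldl-Agree []       []              L′~L = L′~L
  minorAt-foldl-Agree (x ∷ xs) (x∉xs ∷ unique) L′~L =
    minorAt-foldl-Agree xs unique (minorAt-Agree x x∉xs L′~L)

  rankL-Agree : {L′ L : List (AdS n)} → Pointwise (Agree []) L′ L → {S : AdS n} → Disjoint S T →
                rankL L′ S ≡ rankL L S
  rankL-Agree {L′} {L} L′~L {S} S⊥T = begin
    rankL L′ S                  ≡⟨ rankL≡maxℤ L′ S ⟩
    maxℤ (map (rankTerm S) L′)
      ≡⟨ cong maxℤ (Pointwise.Pointwise-≡⇒≡
           (Pointwise.map⁺ (rankTerm S) (rankTerm S) (Pointwise.map same-rank L′~L))) ⟩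
    maxℤ (map (rankTerm S) L)   ≡⟨ sym (rankL≡maxℤ L S) ⟩
    rankL L S                   ∎
    where
    open ≡-Reasoning
    same-rank : ∀ {B′ B} → Agree [] B′ B → rankTerm S B′ ≡ rankTerm S B
    same-rank agree = rankTerm-congʳ λ j → map₂ (λ Tj → agree j (inj₂ Tj)) (S⊥T j)

rankL-minorL : (A B : Sub n) (F : List (AdS n)) {S : AdS n} → Disjoint S (pos A ∪ₐ bar B) →
               rankL (minorL A B F) S ≡ rankL (selectAll (pos A ∪ₐ bar B) (allFin n) F) S
rankL-minorL {n} A B F {S} S⊥AB =
  trans (cong (λ L → rankL L S) (minorL≡foldl-minorAt A B F))
        (rankL-Agree AB (minorAt-foldl-Agree AB (allFin n) (allFin⁺ n) (Pointwise.refl (λ _ _ → refl)))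
                     S⊥AB)
  where AB = pos A ∪ₐ bar B

disjoint-pos∪bar : (A B : Sub n) {S : AdS n} → (∀ i → A i ≡ true ⊎ B i ≡ true → S i ≡ nothing) →
                   Disjoint S (pos A ∪ₐ bar B)
disjoint-pos∪bar A B {S} S⊥A∪B i = map₂ (trans (∪ₐ-<∣> (pos A) (bar B) i)) by-cases
  where
  by-cases : S i ≡ nothing ⊎ pos A i <∣> bar B i ≡ nothing
  by-cases with A i in Ai | B i in Bi
  ... | true  | _     = inj₁ (S⊥A∪B i (inj₁ Ai))
  ... | false | true  = inj₁ (S⊥A∪B i (inj₂ Bi))
  ... | false | false = inj₂ refl

proposition2p3 : ∀ {n : ℕ} (D : DeltaMatroid n) (A B : Sub n) (S : AdS n) →
    (∀ (i : Fin n) → A i ≡ true → B i ≡ false) →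
    (∀ (i : Fin n) → A i ≡ true ⊎ B i ≡ true → S i ≡ nothing) →
    gMinor D A B S ≡ g D (S ∪ₐ (pos A ∪ₐ bar B)) - g D (pos A ∪ₐ bar B)
proposition2p3 {n} D A B S _ S⊥A∪B = begin
  gMinor D A B S
    ≡⟨ rankL-minorL A B (feasible D) S⊥AB ⟩
  rankL (selectAll AB (allFin n) (feasible D)) S
    ≡⟨ rankL-selectAll D AB (allFin n) (allFin⁺ n) (λ j j∉ → contradiction (∈-allFin j) j∉)
                       (feasible-face D) S S⊥AB ⟩
  g D (S ∪ₐ AB) - g D AB ∎
  where
  open ≡-Reasoning
  AB = pos A ∪ₐ bar B
  S⊥AB = disjoint-pos∪bar A B S⊥A∪B
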